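{- Let $1\le m\le n$ and let $Q$ be the type $A_n$ quiver $1\rightarrow 2\rightarrow\cdots\rightarrow m\leftarrow\cdots\leftarrow n-1\leftarrow n$ with minuscule vertex $m$. Then for every $M\in\mathcal{C}_{Q,m}$, $\rho_{Q,m}(M)=Pak(M)$, where $\mathsf P_{Q,m}$ is identified with the cells of the rectangular Young diagram with $n+1-m$ rows of length $m$ as described below.
   Context: Let $\Bbbk$ be an algebraically closed field. $\tau$ is the Auslander–Reiten translation. $\mathsf{P}_{Q,m}$ is the set of isomorphism classes of indecomposable representations $V$ of $Q$ with $V_m\neq0$, partially ordered by the transitive closure of $x<y$ whenever there is an arrow $x\to y$ in the Auslander–Reiten quiver of $Q$; $\lessdot$ denotes covers. $\mathcal{C}_{Q,m}$ is the category of finite direct sums of such indecomposables. Indecomposables of $Q$ are determined by their dimension vectors, which are the $0/1$ vectors supported on an interval of $\{1,\dots,n\}$. Identification with rim hooks and cells: let $\lambda$ be the Young diagram (English notation) with $n+1-m$ rows each of length $m$. Its southeast border consists of $n$ cells; number them $1,\dots,n$ reading from the southwest end to the northeast end. An indecomposable with dimension vector $d$ (supported at $m$) corresponds to the rim hook of $\lambda$ consisting of the border cells $i$ with $d_i=1$, and to the cell $u$ of $\lambda$ whose hook has the same two end cells as this rim hook. Thus $M\in\mathcal C_{Q,m}$ corresponds to a multiset of rim hooks of $\lambda$, and functions on $\mathsf P_{Q,m}$ are identified with fillings of $\lambda$. $Pak(M)$ denotes the reverse plane partition of shape $\lambda$ assigned to this multiset of rim hooks by Pak's bijection (Pak, "Hook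 length formula and geometric combinatorics", 2001). Toggles: for $\rho:\mathsf P_{Q,m}\to[0,N]$ and $x\in\mathsf P_{Q,m}$, $t_x\rho$ agrees with $\rho$ except at $x$, where $t_x\rho(x)=\max_{x\lessdot y}\rho(y)+\min_{z\lessdot x}\rho(z)-\rho(x)$, with max over the empty set $=0$, min over the empty set $=N$. The map $\rho_{Q,m}$: fix a listing $M_1,\dots,M_s$ of all indecomposable representations of $Q$ up to isomorphism such that whenever there is an arrow $M_i\to M_j$ in the Auslander–Reiten quiver, $j<i$. For $M\cong\bigoplus_{j}M_j^{c_j}$, let $\rho_0\equiv0$ and for $k=1,\dots,s$, $x\in\mathsf P_{Q,m}$: $\rho_k(x)=\max_{x\lessdot y}\rho_{k-1}(y)+c_k$ if $x$ corresponds to $M_k$; $\rho_k(x)=(t_x\rho_{k-1})(x)$ if $x$ corresponds to $\tau^{\ell}(M_k)$ for some $\ell<0$; $\rho_k(x)=\rho_{k-1}(x)$ otherwise (independent of $N$). Set $\rho_{Q,m}(M)=\rho_s$. -}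

module Defs where

-- Conventions:
--  * an indecomposable representation of Q (type A_n, orientation
--    1 → 2 → ⋯ → m ← ⋯ ← n) is identified with the interval [a , b]
--    (1 ≤ a ≤ b ≤ n) supporting its dimension vector; we encode it as
--    the pair (a , b) : ℕ × ℕ.
--  * P_{Q,m} = intervals with a ≤ m ≤ b.
--  * a cell of the Young diagram λ (n+1-m rows of length m, English
--    notation) is a pair (row , column), 1-based.
--  * all piecewise-linear computations are carried out in ℤ, so that no
--    truncated subtraction is involved.

open import Data.Nat as ℕ using (ℕ; zero; suc; _≤ᵇ_; _<ᵇ_; _≡ᵇ_)
open import Data.Integer as ℤ using (ℤ; +_)
open import Data.Bool using (Bool; true; false; _∧_; if_then_else_)
open import Data.Product using (_×_; _,_)
open import Data.List using (List; []; _∷_; _++_; map; filterᵇ; foldl;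
  cartesianProduct; upTo; length; lookup)
open import Data.Bool.ListAction using (any)
open import Data.Maybe using (Maybe; just; nothing)
open import Data.Fin using (Fin; toℕ)
open import Data.List.Membership.Propositional using (_∈_)
open import Data.List.Relation.Binary.Permutation.Propositional using (_↭_)

Ind : Set
Ind = ℕ × ℕ

_==_ : Ind → Ind → Bool
(a , b) == (c , d) = (a ≡ᵇ c) ∧ (b ≡ᵇ d)

range : ℕ → ℕ → List ℕ
range lo hi = filterᵇ (λ k → lo ≤ᵇ k) (upTo (suc hi))

allIntervals : ℕ → List Ind
allIntervals n =
  filterᵇ (λ { (a , b) → (1 ≤ᵇ a) ∧ (a ≤ᵇ b) })
          (cartesianProduct (upTo (suc n)) (upTo (suc n)))

inPᵇ : ℕ → ℕ → Ind → Bool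
inPᵇ n m (a , b) = (1 ≤ᵇ a) ∧ (a ≤ᵇ m) ∧ (m ≤ᵇ b) ∧ (b ≤ᵇ n)

Pelems : ℕ → ℕ → List Ind
Pelems n m = filterᵇ (inPᵇ n m) (allIntervals n)

-- Arrows out of the interval module [a , b]: the Butler–Ringel
-- "add a hook / delete a cohook" rule at each end of the string,
-- specialised to this orientation (edge (k-1,k) points k-1 → k iff k ≤ m).
--  left end : if 1 < a ≤ m, add a hook:        [a,b] → [a-1,b];
--             otherwise delete a cohook:       [a,b] → [max(a+1,m+1), b]
--             (if this is nonempty);
--  right end: if m ≤ b < n, add a hook:        [a,b] → [a,b+1];
--             otherwise delete a cohook:       [a,b] → [a, min(b-1,m-1)]
--             (if this is nonempty).
arrowsOut : ℕ → ℕ → Ind → List Ind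
arrowsOut n m (a , b) = left ++ right
  where
  left : List Ind
  left = if (1 <ᵇ a) ∧ (a ≤ᵇ m) then (a ℕ.∸ 1 , b) ∷ []
         else (if (suc a ℕ.⊔ suc m) ≤ᵇ b then (suc a ℕ.⊔ suc m , b) ∷ [] else [])
  right : List Ind
  right = if (m ≤ᵇ b) ∧ (b <ᵇ n) then (a , suc b) ∷ []
          else (if a ≤ᵇ ((b ℕ.∸ 1) ℕ.⊓ (m ℕ.∸ 1)) then (a , (b ℕ.∸ 1) ℕ.⊓ (m ℕ.∸ 1)) ∷ [] else [])

ARArrow : ℕ → ℕ → Ind → Ind → Set
ARArrow n m X Y = Y ∈ arrowsOut n m X

-- inverse Auslander–Reiten translate τ⁻¹ (nothing = X is injective)
tauInv : ℕ → ℕ → Ind → Maybe Ind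
tauInv n m (a , b) = if L ≤ᵇ R then just (L , R) else nothing
  where
  L : ℕ
  L = if a ≡ᵇ 1 then suc m else (if a ≤ᵇ m then a ℕ.∸ 1 else suc a)
  R : ℕ
  R = if b ≡ᵇ n then m ℕ.∸ 1 else (if m ≤ᵇ b then suc b else b ℕ.∸ 1)

-- τ⁻¹ X , τ⁻² X , … (with fuel; the fuel n * n exceeds the number
-- n(n+1)/2 of indecomposables, hence the length of any τ-orbit)
orbitFuel : ℕ → ℕ → ℕ → Ind → List Ind
orbitFuel n m zero    X = []
orbitFuel n m (suc k) X with tauInv n m X
... | nothing = []
... | just Y  = Y ∷ orbitFuel n m k Y

negTauOrbit : ℕ → ℕ → Ind → List Ind
negTauOrbit n m X = orbitFuel n m (n ℕ.* n) X

-- The poset P_{Q,m}: covers are the arrows of the AR quiver between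
-- elements of P_{Q,m}.
upperCovers : ℕ → ℕ → Ind → List Ind
upperCovers n m x = filterᵇ (inPᵇ n m) (arrowsOut n m x)

lowerCovers : ℕ → ℕ → Ind → List Ind
lowerCovers n m x = filterᵇ (λ z → any (_== x) (arrowsOut n m z)) (Pelems n m)

-- max with max ∅ = 0, min with min ∅ = N
maxL : List ℤ → ℤ
maxL []       = + 0
maxL (x ∷ []) = x
maxL (x ∷ xs) = x ℤ.⊔ maxL xs

minL : ℤ → List ℤ → ℤ
minL N []       = N
minL N (x ∷ []) = x
minL N (x ∷ xs) = x ℤ.⊓ minL N xs

-- toggle at x (value at x only), for ρ : P_{Q,m} → [0,N]
toggleAt : ℕ → ℕ → ℕ → (Ind → ℤ) → Ind → ℤ
toggleAt n m N ρ x =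
  (maxL (map ρ (upperCovers n m x)) ℤ.+ minL (+ N) (map ρ (lowerCovers n m x))) ℤ.- ρ x

ValidListing : ℕ → ℕ → List Ind → Set
ValidListing n m L =
  (L ↭ allIntervals n) ×
  ((i j : Fin (length L)) → ARArrow n m (lookup L i) (lookup L j) → toℕ j ℕ.< toℕ i)

-- one step ρ_{k-1} ↦ ρ_k, where Mk is the k-th listed indecomposable and
-- M gives the multiplicities c_k of the object M ∈ 𝒞_{Q,m}
rhoStep : ℕ → ℕ → ℕ → (Ind → ℕ) → (Ind → ℤ) → Ind → (Ind → ℤ)
rhoStep n m N M ρ Mk x =
  if inPᵇ n m x
  then (if x == Mk
        then maxL (map ρ (upperCovers n m x)) ℤ.+ + (M Mk)
        else (if any (_== x) (negTauOrbit n m Mk)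
              then toggleAt n m N ρ x
              else ρ x))
  else ρ x

-- ρ_{Q,m}(M) computed with the listing L (values outside P_{Q,m} are 0
-- and irrelevant)
rhoQm : ℕ → ℕ → ℕ → List Ind → (Ind → ℕ) → (Ind → ℤ)
rhoQm n m N L M = foldl (rhoStep n m N M) (λ _ → + 0) L

-- Pak's bijection (hook weights ↦ reverse plane partition), shape with
-- R rows of length C.  Cells are added in row-major order; when the cell
-- (i,j) is added, each cell (i-k , j-k), k ≥ 1, on its diagonal is
-- toggled, π(u) ↦ max(NW neighbours) + min(SE neighbours) − π(u), and
-- the new cell gets  max(π(i-1,j), π(i,j-1)) + f(i,j).

Cell : Set
Cell = ℕ × ℕ

nwMax : (Cell → ℤ) → Cell → ℤ
nwMax π (r , c) =
  maxL ((if 1 <ᵇ r then π (r ℕ.∸ 1 , c) ∷ [] else []) ++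
        (if 1 <ᵇ c then π (r , c ℕ.∸ 1) ∷ [] else []))

pakAdd : (Cell → ℕ) → (Cell → ℤ) → Cell → (Cell → ℤ)
pakAdd f π (i , j) (r , c) =
  if (r , c) == (i , j)
  then nwMax π (i , j) ℤ.+ + f (i , j)
  else (if (r <ᵇ i) ∧ (c <ᵇ j) ∧ ((i ℕ.∸ r) ≡ᵇ (j ℕ.∸ c))
        then (nwMax π (r , c) ℤ.+ (π (suc r , c) ℤ.⊓ π (r , suc c))) ℤ.- π (r , c)
        else π (r , c))

cellsRowMajor : ℕ → ℕ → List Cell
cellsRowMajor R C = cartesianProduct (range 1 R) (range 1 C)

PakRPP : ℕ → ℕ → (Cell → ℕ) → (Cell → ℤ)
PakRPP R C f = foldl (pakAdd f) (λ _ → + 0) (cellsRowMajor R C)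

-- the cell u of λ whose hook has the same end cells as the rim hook of
-- the interval [a , b] (border cells numbered 1..n from SW to NE)
cellOf : ℕ → Ind → Cell
cellOf n (a , b) = (suc n ℕ.∸ b , a)

hookWeights : ℕ → (Ind → ℕ) → (Cell → ℕ)
hookWeights n M (r , c) = M (c , suc n ℕ.∸ r)

Pak : ℕ → ℕ → (Ind → ℕ) → (Cell → ℤ)
Pak n m M = PakRPP (suc n ℕ.∸ m) m (hookWeights n M)

{-# OPTIONS --safe #-}
-- The value finally left at a cell depends only
-- on how far its diagonal has been filled, so every order that adds each cell after its upper
-- and left neighbours gives the same result.
-- When intervals are identified with cells, P_{Q,m} is the rectangle, the arrows of the
-- Auslander–Reiten quiver inside P_{Q,m} go from a cell to its upper and left neighbours, the
-- lower covers of an interior cell are its lower and right neighbours, and the part of a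
-- τ⁻¹-orbit inside P_{Q,m} is the diagonal north-west of the cell.  So each step of ρ_{Q,m} is a
-- step of Pak's algorithm, the listing of the indecomposables induces such an order on the
-- cells, and ρ_{Q,m}(M) = Pak(M).
module Submission where

open import Defs
open import Data.Nat
  using (ℕ; zero; suc; _+_; _*_; _∸_; _⊓_; _⊔_; _≤_; _<_; z≤n; s≤s; _≟_; _≤?_; _<?_; _≤ᵇ_; _<ᵇ_; _≡ᵇ_;
         >-nonZero)
open import Data.Nat.Properties
  using (+-suc; +-identityʳ; +-comm; +-∸-assoc; m+n∸m≡n; m+n∸n≡m; m+[n∸m]≡n; m∸[m∸n]≡n; m∸n≤m;
         m<m+n; m+1+n≢m; +-monoʳ-≤; +-monoʳ-<; ∸-monoˡ-≤; ∸-monoʳ-≤; ∸-monoʳ-<; ∸-cancelˡ-≡; ∸-cancelʳ-<;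
         m<n⇒0<n∸m; m≤m*n; m≤n⊔m; m⊓n≤m; m⊓n≤n; ⊓-sel; ≤ᵇ⇒≤; ≤⇒≤ᵇ; suc-injective; 1+n≢n;
         ≤-refl; ≤-reflexive; ≤-trans; ≤-pred; <-≤-trans; ≤-<-trans; <⇒≤; <⇒≱; ≮⇒≥; ≰⇒>; ≤∧≢⇒<;
         <-irrefl; <-cmp; n≤1+n; n<1⇒n≡0; m≤n⇒m≤1+n; m<n⇒m<1+n; m≤n⇒m<n∨m≡n)
open import Data.Integer as ℤ using (ℤ; +_)
import Data.Integer.Properties as ℤ
open import Data.Bool using (Bool; true; false; T; _∧_; if_then_else_)
open import Data.Bool.ListAction using (any)
open import Data.Bool.Properties using (T-∨)
open import Data.Unit using (tt)
open import Data.Empty using (⊥; ⊥-elim)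
open import Data.Maybe using (just)
open import Data.Product using (_×_; _,_; proj₁; proj₂; ∃-syntax)
open import Data.Product.Properties using (,-injective)
open import Data.Product.Relation.Binary.Lex.Strict using (×-Lex)
open import Data.Sum as Sum using (_⊎_; inj₁; inj₂)
open import Data.Fin using (toℕ)
open import Data.List using (List; []; _∷_; _++_; map; filterᵇ; foldl; length; cartesianProduct)
open import Data.List.Properties
  using (++-identityʳ; ++-assoc; map-++; filter-++; filter-accept; filter-reject; ∷-injectiveˡ; ∷-injectiveʳ)
open import Data.List.Membership.Propositional using (_∈_; _∉_)
open import Data.List.Membership.Propositional.Properties
  using (∈-++⁺ˡ; ∈-++⁺ʳ; ∈-++⁻; ∈-map⁺; ∈-map⁻; ∈-filter⁺; ∈-filter⁻; ∈-upTo⁺; ∈-upTo⁻;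
         ∈-cartesianProduct⁺; ∈-cartesianProduct⁻)
open import Data.List.Relation.Unary.Any as Any using (here; there)
open import Data.List.Relation.Unary.Any.Properties using (lookup-index)
open import Data.List.Relation.Unary.All as All using (All; []; _∷_)
import Data.List.Relation.Unary.All.Properties as All
open import Data.List.Relation.Unary.AllPairs as AllPairs using (AllPairs; []; _∷_)
import Data.List.Relation.Unary.AllPairs.Properties as AllPairs
open import Data.List.Relation.Unary.Unique.Propositional using (Unique)
import Data.List.Relation.Unary.Unique.Propositional.Properties as Unique
open import Data.List.Relation.Binary.Permutation.Propositional using (↭-sym; ↭⇒↭ₛ)
open import Data.List.Relation.Binary.Permutation.Propositional.Properties using (∈-resp-↭)
import Data.List.Relation.Binary.Permutation.Setoid.Properties as Permutationₛ
open import Function using (_∘_; id; Equivalence)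
open import Relation.Nullary using (¬_; Dec; yes; no; does; _because_; _×-dec_)
open import Relation.Nullary.Decidable using (map′; dec-true; dec-false; T?)
open import Relation.Nullary.Reflects using (fromEquivalence)
open import Relation.Binary using (DecidableEquality; tri<; tri≈; tri>)
open import Relation.Binary.PropositionalEquality
  using (_≡_; _≢_; refl; sym; trans; cong; cong₂; subst; subst₂; setoid; module ≡-Reasoning)

open ≡-Reasoning

-- The boolean tests in Defs are definitionally `does` of decision procedures (`_≤?_`, `_<?_`,
-- `_≟_`, and `_≟²_`, `_∈ᵢ?_`, `_⋱?_`, `Quiver.inP?` below), so `if-yes` and `if-no` evaluate them.
if-yes : ∀ {p} {P : Set p} {A : Set} (P? : Dec P) {x y : A} → P → (if does P? then x else y) ≡ x
if-yes P? p rewrite dec-true P? p = refl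

if-no : ∀ {p} {P : Set p} {A : Set} (P? : Dec P) {x y : A} → ¬ P → (if does P? then x else y) ≡ y
if-no P? ¬p rewrite dec-false P? ¬p = refl

T-does⇒ : ∀ {p} {P : Set p} (P? : Dec P) → T (does P?) → P
T-does⇒ P? t with P?
... | yes p = p

⇒T-does : ∀ {p} {P : Set p} (P? : Dec P) → P → T (does P?)
⇒T-does P? p rewrite dec-true P? p = tt

_≟²_ : DecidableEquality (ℕ × ℕ)
(a , b) ≟² (c , d) = map′ (λ (p , q) → cong₂ _,_ p q) ,-injective (a ≟ c ×-dec b ≟ d)

any-==⇒∈ : ∀ {x : Ind} xs → T (any (_== x) xs) → x ∈ xs
any-==⇒∈ {x} (y ∷ ys) t with Equivalence.to T-∨ t
... | inj₁ y==x = here (sym (T-does⇒ (y ≟² x) y==x))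
... | inj₂ t′   = there (any-==⇒∈ ys t′)

∈⇒any-== : ∀ {x : Ind} xs → x ∈ xs → T (any (_== x) xs)
∈⇒any-== (y ∷ ys) (here refl) = Equivalence.from T-∨ (inj₁ (⇒T-does (y ≟² y) refl))
∈⇒any-== (y ∷ ys) (there x∈) = Equivalence.from T-∨ (inj₂ (∈⇒any-== ys x∈))

_∈ᵢ?_ : ∀ (x : Ind) xs → Dec (x ∈ xs)
x ∈ᵢ? xs = any (_== x) xs because fromEquivalence (any-==⇒∈ xs) (∈⇒any-== xs)

∈-∷ʳ⁻ : ∀ {A : Set} {x y : A} xs → x ∈ xs ++ y ∷ [] → x ∈ xs ⊎ x ≡ y
∈-∷ʳ⁻ xs x∈ with ∈-++⁻ xs x∈
... | inj₁ x∈xs = inj₁ x∈xs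
... | inj₂ (here x≡y) = inj₂ x≡y

∈-∷ʳ⁺ : ∀ {A : Set} {y : A} xs → y ∈ xs ++ y ∷ []
∈-∷ʳ⁺ xs = ∈-++⁺ʳ xs (here refl)

AllPairs-++-∷ : ∀ {A : Set} {_~_ : A → A → Set} xs {y ys} →
                AllPairs _~_ (xs ++ y ∷ ys) → All (_~ y) xs × All (y ~_) ys
AllPairs-++-∷ []       (y~ys ∷ _)      = [] , y~ys
AllPairs-++-∷ (x ∷ xs) (x~rest ∷ rest) =
  (All.head (All.++⁻ʳ xs x~rest) ∷ proj₁ (AllPairs-++-∷ xs rest)) , proj₂ (AllPairs-++-∷ xs rest)

index-++⁺ʳ : ∀ {A : Set} {x : A} xs {ys} (x∈ : x ∈ ys) →
             toℕ (Any.index (∈-++⁺ʳ xs x∈)) ≡ length xs + toℕ (Any.index x∈)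
index-++⁺ʳ []       x∈ = refl
index-++⁺ʳ (_ ∷ xs) x∈ = cong suc (index-++⁺ʳ xs x∈)

map-filterᵇ-split : ∀ {A B : Set} (f : A → B) (P : A → Bool) xs {ys y zs} →
                    map f (filterᵇ P xs) ≡ ys ++ y ∷ zs →
                    ∃[ ps ] ∃[ x ] ∃[ qs ] xs ≡ ps ++ x ∷ qs × map f (filterᵇ P ps) ≡ ys × f x ≡ y × T (P x)
map-filterᵇ-split f P []       {[]}    ()
map-filterᵇ-split f P []       {_ ∷ _} ()
map-filterᵇ-split f P (x ∷ xs) eq with P x in Px
map-filterᵇ-split f P (x ∷ xs) eq | false with map-filterᵇ-split f P xs eq
... | ps , x′ , qs , refl , ps↦ys , fx′ , Px′ =
  x ∷ ps , x′ , qs , refl , trans (cong (map f) (filter-reject (T? ∘ P) (subst T Px))) ps↦ys , fx′ , Px′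
map-filterᵇ-split f P (x ∷ xs) {[]} eq | true =
  [] , x , xs , refl , refl , ∷-injectiveˡ eq , subst T (sym Px) tt
map-filterᵇ-split f P (x ∷ xs) {_ ∷ _} eq | true with map-filterᵇ-split f P xs (∷-injectiveʳ eq)
... | ps , x′ , qs , refl , ps↦ys , fx′ , Px′ =
  x ∷ ps , x′ , qs , refl ,
  trans (cong (map f) (filter-accept (T? ∘ P) (subst T (sym Px) tt))) (cong₂ _∷_ (∷-injectiveˡ eq) ps↦ys) ,
  fx′ , Px′

minL-attained : ∀ N {x} (xs : List ℤ) → x ∈ xs → minL N xs ∈ xs
minL-attained N (x ∷ [])     _ = here refl
minL-attained N (x ∷ y ∷ ys) _ with minL-attained N (y ∷ ys) (here refl) | ℤ.⊓-sel x (minL N (y ∷ ys))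
... | _        | inj₁ min≡x    = here min≡x
... | rest-min | inj₂ min≡rest = there (subst (_∈ _) (sym min≡rest) rest-min)

minL-≤ : ∀ N {x} xs → x ∈ xs → minL N xs ℤ.≤ x
minL-≤ N (x ∷ [])     (here refl) = ℤ.≤-refl
minL-≤ N (x ∷ y ∷ ys) (here refl) = ℤ.i⊓j≤i x _
minL-≤ N (x ∷ y ∷ ys) (there z∈)  = ℤ.≤-trans (ℤ.i⊓j≤j x _) (minL-≤ N (y ∷ ys) z∈)

minL-pair : ∀ N {u v} xs → u ∈ xs → v ∈ xs → (∀ {z} → z ∈ xs → z ≡ u ⊎ z ≡ v) → minL N xs ≡ u ℤ.⊓ v
minL-pair N xs u∈ v∈ onlyUV with onlyUV (minL-attained N xs u∈)
... | inj₁ min≡u = trans min≡u (sym (ℤ.i≤j⇒i⊓j≡i (subst (ℤ._≤ _) min≡u (minL-≤ N xs v∈))))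
... | inj₂ min≡v = trans min≡v (sym (ℤ.i≥j⇒i⊓j≡j (subst (ℤ._≤ _) min≡v (minL-≤ N xs u∈))))

maxL-swap : ∀ (b₁ b₂ : Bool) (x y : ℤ) →
            maxL ((if b₁ then x ∷ [] else []) ++ (if b₂ then y ∷ [] else [])) ≡
            maxL ((if b₂ then y ∷ [] else []) ++ (if b₁ then x ∷ [] else []))
maxL-swap true  true  x y = ℤ.⊔-comm x y
maxL-swap true  false x y = refl
maxL-swap false true  x y = refl
maxL-swap false false x y = refl

-- Diagonals of the rectangle

Rect : ℕ → ℕ → Cell → Set
Rect R C (r , c) = 1 ≤ r × r ≤ R × 1 ≤ c × c ≤ C

infix 4 _⋱_ _⋱?_

_⋱_ : Cell → Cell → Set
(r , c) ⋱ (i , j) = ∃[ k ] i ≡ r + suc k × j ≡ c + suc k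

⋱⇒≢ : ∀ {x e} → x ⋱ e → x ≢ e
⋱⇒≢ {r , _} (k , refl , _) x≡e = m+1+n≢m r (sym (cong proj₁ x≡e))

diff⇒⋱ : ∀ {r c i j} → r < i × c < j × i ∸ r ≡ j ∸ c → (r , c) ⋱ (i , j)
diff⇒⋱ {r} {c} {i} {j} (r<i , c<j , i∸r≡j∸c) = i ∸ suc r , onRow , onColumn
  where
  gap : suc (i ∸ suc r) ≡ i ∸ r
  gap = sym (+-∸-assoc 1 r<i)
  onRow : i ≡ r + suc (i ∸ suc r)
  onRow = trans (sym (m+[n∸m]≡n (<⇒≤ r<i))) (cong (λ d → r + d) (sym gap))
  onColumn : j ≡ c + suc (i ∸ suc r)
  onColumn = trans (sym (m+[n∸m]≡n (<⇒≤ c<j))) (cong (λ d → c + d) (sym (trans gap i∸r≡j∸c)))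

⋱⇒diff : ∀ {r c i j} → (r , c) ⋱ (i , j) → r < i × c < j × i ∸ r ≡ j ∸ c
⋱⇒diff {r} {c} (k , refl , refl) =
  m<m+n r (s≤s z≤n) , m<m+n c (s≤s z≤n) , trans (m+n∸m≡n r (suc k)) (sym (m+n∸m≡n c (suc k)))

_⋱?_ : ∀ x e → Dec (x ⋱ e)
(r , c) ⋱? (i , j) = map′ diff⇒⋱ ⋱⇒diff (r <? i ×-dec c <? j ×-dec i ∸ r ≟ j ∸ c)

diagonal⇒≡⊎⋱ : ∀ r c k {e} → (r + k , c + k) ≡ e → (r , c) ≡ e ⊎ (r , c) ⋱ e
diagonal⇒≡⊎⋱ r c zero refl = inj₁ (sym (cong₂ _,_ (+-identityʳ r) (+-identityʳ c)))
diagonal⇒≡⊎⋱ r c (suc k) refl = inj₂ (k , refl , refl)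

⋱-suc⁺ : ∀ {r′ c′ r c} → (r′ , c′) ≡ (r , c) ⊎ (r′ , c′) ⋱ (r , c) → (r′ , c′) ⋱ (suc r , suc c)
⋱-suc⁺ {r′} {c′} (inj₁ refl) = 0 , +-comm 1 r′ , +-comm 1 c′
⋱-suc⁺ {r′} {c′} (inj₂ (k , hi , hj)) = suc k , trans (cong suc hi) (sym (+-suc r′ (suc k)))
                                              , trans (cong suc hj) (sym (+-suc c′ (suc k)))

⋱-suc⁻ : ∀ {r′ c′ r c} → (r′ , c′) ⋱ (suc r , suc c) → (r′ , c′) ≡ (r , c) ⊎ (r′ , c′) ⋱ (r , c)
⋱-suc⁻ {r′} {c′} (k , hi , hj) =
  diagonal⇒≡⊎⋱ r′ c′ k
    (sym (cong₂ _,_ (suc-injective (trans hi (+-suc r′ k))) (suc-injective (trans hj (+-suc c′ k)))))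

toggle : (Cell → ℤ) → Cell → ℤ
toggle π (r , c) = nwMax π (r , c) ℤ.+ (π (suc r , c) ℤ.⊓ π (r , suc c)) ℤ.- π (r , c)

module _ (f : Cell → ℕ) (π : Cell → ℤ) where

  pakAdd-new : ∀ e → pakAdd f π e e ≡ nwMax π e ℤ.+ + f e
  pakAdd-new e = if-yes (e ≟² e) refl

  pakAdd-toggled : ∀ {x e} → x ⋱ e → pakAdd f π e x ≡ toggle π x
  pakAdd-toggled {x} {e} x⋱e = trans (if-no (x ≟² e) (⋱⇒≢ x⋱e)) (if-yes (x ⋱? e) x⋱e)

  pakAdd-untouched : ∀ {x e} → x ≢ e → ¬ x ⋱ e → pakAdd f π e x ≡ π x
  pakAdd-untouched {x} {e} x≢e ¬x⋱e = trans (if-no (x ≟² e) x≢e) (if-no (x ⋱? e) ¬x⋱e)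

-- Pak's algorithm along a linear extension of the cells

LowerClosed : List Cell → Set
LowerClosed p = ∀ {i j r c} → (i , j) ∈ p → 1 ≤ r → 1 ≤ c → r ≤ i → c ≤ j → (r , c) ∈ p

record DiagonalEnd (p : List Cell) (r c k : ℕ) : Set where
  constructor ends
  field
    last∈ : (r + k , c + k) ∈ p
    next∉ : (suc (r + k) , suc (c + k)) ∉ p

diagonalEnd : ∀ {p r c k i j} → i ≡ r + k → j ≡ c + k → (i , j) ∈ p → (suc i , suc j) ∉ p →
              DiagonalEnd p r c k
diagonalEnd refl refl ij∈p next∉p = ends ij∈p next∉p

diagonalEnd-unique : ∀ {p r c k k′} → LowerClosed p →
                     DiagonalEnd p r c k → DiagonalEnd p r c k′ → k ≡ k′
diagonalEnd-unique {r = r} {c} {k} {k′} closed (ends in₁ out₁) (ends in₂ out₂) with <-cmp k k′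
... | tri< k<k′ _ _ = ⊥-elim (out₁ (closed in₂ (s≤s z≤n) (s≤s z≤n) (+-monoʳ-< r k<k′) (+-monoʳ-< c k<k′)))
... | tri≈ _ k≡k′ _ = k≡k′
... | tri> _ _ k′<k = ⊥-elim (out₂ (closed in₁ (s≤s z≤n) (s≤s z≤n) (+-monoʳ-< r k′<k) (+-monoʳ-< c k′<k)))

record Addable (p : List Cell) (i j : ℕ) : Set where
  field
    fresh      : (i , j) ∉ p
    aboveAdded : 1 < i → (i ∸ 1 , j) ∈ p
    leftAdded  : 1 < j → (i , j ∸ 1) ∈ p

record LinearExtension (R C : ℕ) (l : List Cell) : Set where
  field
    inRect   : ∀ {x} → x ∈ l → Rect R C x
    complete : ∀ {x} → Rect R C x → x ∈ l
    addable  : ∀ {p i j q} → l ≡ p ++ (i , j) ∷ q → Addable p i j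

module PakGrowth (f : Cell → ℕ) where

  -- `entry k r c` is the value Pak's algorithm leaves at (r , c) once its diagonal has been
  -- added up to (r + k , c + k).
  mutual
    entry : ℕ → ℕ → ℕ → ℤ
    entry zero    r c = maxL (entryAbove zero r c ++ entryLeft zero r c) ℤ.+ + f (r , c)
    entry (suc k) r c =
      maxL (entryAbove (suc k) r c ++ entryLeft (suc k) r c) ℤ.+ (entry k (suc r) c ℤ.⊓ entry k r (suc c))
        ℤ.- entry k r c

    entryAbove : ℕ → ℕ → ℕ → List ℤ
    entryAbove k (suc (suc r)) c = entry k (suc r) c ∷ []
    entryAbove k _             c = []

    entryLeft : ℕ → ℕ → ℕ → List ℤ
    entryLeft k r (suc (suc c)) = entry k r (suc c) ∷ []
    entryLeft k r _             = []

  nwMax≡entry : ∀ {π : Cell → ℤ} k r c →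
                (1 < r → π (r ∸ 1 , c) ≡ entry k (r ∸ 1) c) →
                (1 < c → π (r , c ∸ 1) ≡ entry k r (c ∸ 1)) →
                nwMax π (r , c) ≡ maxL (entryAbove k r c ++ entryLeft k r c)
  nwMax≡entry {π} k r c above left = cong maxL (cong₂ _++_ (fromAbove r above) (fromLeft c left))
    where
    fromAbove : ∀ r → (1 < r → π (r ∸ 1 , c) ≡ entry k (r ∸ 1) c) →
                (if 1 <ᵇ r then π (r ∸ 1 , c) ∷ [] else []) ≡ entryAbove k r c
    fromAbove zero          _     = refl
    fromAbove (suc zero)    _     = refl
    fromAbove (suc (suc r)) above = cong (_∷ []) (above (s≤s (s≤s z≤n)))
    fromLeft : ∀ c → (1 < c → π (r , c ∸ 1) ≡ entry k r (c ∸ 1)) →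
               (if 1 <ᵇ c then π (r , c ∸ 1) ∷ [] else []) ≡ entryLeft k r c
    fromLeft zero          _    = refl
    fromLeft (suc zero)    _    = refl
    fromLeft (suc (suc c)) left = cong (_∷ []) (left (s≤s (s≤s z≤n)))

  -- Only cells with positive coordinates are tracked: `pakAdd` also toggles cells in row or
  -- column 0, which lie outside the rectangle.
  record GrowthInvariant (R C : ℕ) (p : List Cell) (π : Cell → ℤ) : Set where
    field
      inRect      : ∀ {x} → x ∈ p → Rect R C x
      lowerClosed : LowerClosed p
      entryAt     : ∀ {r c} k → DiagonalEnd p (suc r) (suc c) k → π (suc r , suc c) ≡ entry k (suc r) (suc c)

  module AddCell {R C p π} (I : GrowthInvariant R C p π) {i j : ℕ}
              (e∈R : Rect R C (suc i , suc j)) (add : Addable p (suc i) (suc j)) where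
    open GrowthInvariant I
    open Addable add

    e : Cell
    e = suc i , suc j

    p′ : List Cell
    p′ = p ++ e ∷ []

    π′ : Cell → ℤ
    π′ = pakAdd f π e

    notSouthEast : ∀ {a b} → suc i ≤ a → suc j ≤ b → (a , b) ∉ p
    notSouthEast i<a j<b ab∈p = fresh (lowerClosed ab∈p (s≤s z≤n) (s≤s z≤n) i<a j<b)

    next∉p′ : (suc (suc i) , suc (suc j)) ∉ p′
    next∉p′ next∈p′ with ∈-∷ʳ⁻ p next∈p′
    ... | inj₁ next∈p = notSouthEast (n≤1+n _) (n≤1+n _) next∈p
    ... | inj₂ next≡e = 1+n≢n (cong proj₁ next≡e)

    aboveEntry : ∀ {r c} k → i ≡ suc r + k → suc j ≡ suc c + k → π (suc r , suc c) ≡ entry k (suc r) (suc c)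
    aboveEntry k refl hj =
      entryAt k (diagonalEnd refl hj (aboveAdded (s≤s (s≤s z≤n))) (notSouthEast ≤-refl (n≤1+n _)))

    leftEntry : ∀ {r c} k → suc i ≡ suc r + k → j ≡ suc c + k → π (suc r , suc c) ≡ entry k (suc r) (suc c)
    leftEntry k hi refl =
      entryAt k (diagonalEnd hi refl (leftAdded (s≤s (s≤s z≤n))) (notSouthEast (n≤1+n _) ≤-refl))

    nwEntry : ∀ {r c} k → i ≡ suc r + k → j ≡ suc c + k → π (suc r , suc c) ≡ entry k (suc r) (suc c)
    nwEntry k refl refl =
      entryAt k (diagonalEnd refl refl
        (lowerClosed (aboveAdded (s≤s (s≤s z≤n))) (s≤s z≤n) (s≤s z≤n) ≤-refl (n≤1+n _)) fresh)

    newEntry : π′ e ≡ entry 0 (suc i) (suc j)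
    newEntry = begin
      pakAdd f π e e                  ≡⟨ pakAdd-new f π e ⟩
      nwMax π e ℤ.+ + f e             ≡⟨ cong (ℤ._+ + f e) (nwMax≡entry {π} 0 (suc i) (suc j) above left) ⟩
      entry 0 (suc i) (suc j)         ∎
      where
      above : 1 < suc i → π (i , suc j) ≡ entry 0 i (suc j)
      above (s≤s {n = suc i′} _) = aboveEntry 0 (sym (+-identityʳ _)) (sym (+-identityʳ _))
      left : 1 < suc j → π (suc i , j) ≡ entry 0 (suc i) j
      left (s≤s {n = suc j′} _) = leftEntry 0 (sym (+-identityʳ _)) (sym (+-identityʳ _))

    toggledEntry : ∀ {r c} k → i ≡ suc r + k → j ≡ suc c + k →
                   π′ (suc r , suc c) ≡ entry (suc k) (suc r) (suc c)
    toggledEntry {r} {c} k hi hj = begin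
      pakAdd f π e (suc r , suc c)
        ≡⟨ pakAdd-toggled f π {suc r , suc c}
             (k , cong suc (trans hi (sym (+-suc r k))) , cong suc (trans hj (sym (+-suc c k)))) ⟩
      toggle π (suc r , suc c)
        ≡⟨ cong₂ ℤ._-_ (cong₂ ℤ._+_ (nwMax≡entry {π} (suc k) (suc r) (suc c) above left)
                                    (cong₂ ℤ._⊓_ below right))
                       (nwEntry k hi hj) ⟩
      entry (suc k) (suc r) (suc c)  ∎
      where
      above : 1 < suc r → π (r , suc c) ≡ entry (suc k) r (suc c)
      above (s≤s {n = suc r′} _) = aboveEntry (suc k) (trans hi (sym (cong suc (+-suc r′ k))))
                                                      (cong suc (trans hj (sym (+-suc c k))))
      left : 1 < suc c → π (suc r , c) ≡ entry (suc k) (suc r) c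
      left (s≤s {n = suc c′} _) = leftEntry (suc k) (cong suc (trans hi (sym (+-suc r k))))
                                                    (trans hj (sym (cong suc (+-suc c′ k))))
      below : π (suc (suc r) , suc c) ≡ entry k (suc (suc r)) (suc c)
      below = leftEntry k (cong suc hi) hj
      right : π (suc r , suc (suc c)) ≡ entry k (suc r) (suc (suc c))
      right = aboveEntry k hi (cong suc hj)

    inRect′ : ∀ {x} → x ∈ p′ → Rect R C x
    inRect′ x∈p′ with ∈-∷ʳ⁻ p x∈p′
    ... | inj₁ x∈p = inRect x∈p
    ... | inj₂ refl = e∈R

    lowerClosed′ : LowerClosed p′
    lowerClosed′ ab∈p′ 1≤r 1≤c r≤a c≤b with ∈-∷ʳ⁻ p ab∈p′
    ... | inj₁ ab∈p = ∈-++⁺ˡ (lowerClosed ab∈p 1≤r 1≤c r≤a c≤b)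
    ... | inj₂ refl with m≤n⇒m<n∨m≡n r≤a | m≤n⇒m<n∨m≡n c≤b
    ...   | inj₂ refl | inj₂ refl = ∈-∷ʳ⁺ p
    ...   | inj₁ (s≤s r≤i) | _ =
      ∈-++⁺ˡ (lowerClosed (aboveAdded (s≤s (≤-trans 1≤r r≤i))) 1≤r 1≤c r≤i c≤b)
    ...   | inj₂ refl | inj₁ (s≤s c≤j) =
      ∈-++⁺ˡ (lowerClosed (leftAdded (s≤s (≤-trans 1≤c c≤j))) 1≤r 1≤c r≤a c≤j)

    -- Adding e changes only the cells on its diagonal; by `diagonalEnd-unique` the diagonal
    -- of e, and of every cell north-west of e on it, now ends at e.
    entryAt′ : ∀ {r c} k → DiagonalEnd p′ (suc r) (suc c) k →
               π′ (suc r , suc c) ≡ entry k (suc r) (suc c)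
    entryAt′ {r} {c} k end with (suc r , suc c) ≟² e | (suc r , suc c) ⋱? e
    ... | yes refl | _ =
      subst (λ k → π′ e ≡ entry k (suc i) (suc j)) (diagonalEnd-unique lowerClosed′ endOfE end) newEntry
      where
      endOfE : DiagonalEnd p′ (suc i) (suc j) 0
      endOfE = diagonalEnd (sym (+-identityʳ _)) (sym (+-identityʳ _)) (∈-∷ʳ⁺ p) next∉p′
    ... | no _ | yes (k′ , hi , hj) =
      subst (λ k → π′ (suc r , suc c) ≡ entry k (suc r) (suc c))
            (diagonalEnd-unique lowerClosed′ (diagonalEnd hi hj (∈-∷ʳ⁺ p) next∉p′) end)
            (toggledEntry k′ (trans (suc-injective hi) (+-suc r k′))
                             (trans (suc-injective hj) (+-suc c k′)))
    ... | no x≢e | no ¬x⋱e =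
      trans (pakAdd-untouched f π x≢e ¬x⋱e) (entryAt k (ends end∈p (DiagonalEnd.next∉ end ∘ ∈-++⁺ˡ)))
      where
      end∈p : (suc r + k , suc c + k) ∈ p
      end∈p with ∈-∷ʳ⁻ p (DiagonalEnd.last∈ end)
      ... | inj₁ end∈p = end∈p
      ... | inj₂ end≡e with diagonal⇒≡⊎⋱ (suc r) (suc c) k end≡e
      ...   | inj₁ x≡e = ⊥-elim (x≢e x≡e)
      ...   | inj₂ x⋱e = ⊥-elim (¬x⋱e x⋱e)

    invariant : GrowthInvariant R C p′ π′
    invariant = record { inRect = inRect′ ; lowerClosed = lowerClosed′ ; entryAt = entryAt′ }

  growthInvariant-[] : ∀ {R C} → GrowthInvariant R C [] (λ _ → + 0)
  growthInvariant-[] = record { inRect = λ () ; lowerClosed = λ () ; entryAt = λ { _ (ends () _) } }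

  growthInvariant-foldl : ∀ {R C l} → LinearExtension R C l → ∀ {p π} q → l ≡ p ++ q →
                          GrowthInvariant R C p π → GrowthInvariant R C l (foldl (pakAdd f) π q)
  growthInvariant-foldl ext {p} [] l≡p I =
    subst (λ l → GrowthInvariant _ _ l _) (sym (trans l≡p (++-identityʳ p))) I
  growthInvariant-foldl ext {p} ((i , j) ∷ q) l≡p++e∷q I
    with LinearExtension.inRect ext (subst ((i , j) ∈_) (sym l≡p++e∷q) (∈-++⁺ʳ p (here refl)))
  ... | e∈R@(s≤s z≤n , _ , s≤s z≤n , _) =
    growthInvariant-foldl ext q (trans l≡p++e∷q (sym (++-assoc p ((i , j) ∷ []) q)))
         (AddCell.invariant I e∈R (LinearExtension.addable ext l≡p++e∷q))

  complete⇒entry : ∀ {R C l π r c} → GrowthInvariant R C l π → (∀ {x} → Rect R C x → x ∈ l) →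
                 Rect R C (r , c) → π (r , c) ≡ entry ((R ∸ r) ⊓ (C ∸ c)) r c
  complete⇒entry {R} {C} {l} {r = suc r} {suc c} I complete (_ , r≤R , _ , c≤C) =
    entryAt k (ends (complete (s≤s z≤n , lastRow , s≤s z≤n , lastCol)) next∉l)
    where
    open GrowthInvariant I
    k = (R ∸ suc r) ⊓ (C ∸ suc c)
    lastRow : suc r + k ≤ R
    lastRow = ≤-trans (+-monoʳ-≤ (suc r) (m⊓n≤m _ _)) (≤-reflexive (m+[n∸m]≡n r≤R))
    lastCol : suc c + k ≤ C
    lastCol = ≤-trans (+-monoʳ-≤ (suc c) (m⊓n≤n _ _)) (≤-reflexive (m+[n∸m]≡n c≤C))
    next∉l : (suc (suc r + k) , suc (suc c + k)) ∉ l
    next∉l next∈l with inRect next∈l | ⊓-sel (R ∸ suc r) (C ∸ suc c)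
    ... | _ , beyondR , _ | inj₁ k≡ = <-irrefl (trans (cong (λ d → suc r + d) k≡) (m+[n∸m]≡n r≤R)) beyondR
    ... | _ , _ , _ , beyondC | inj₂ k≡ = <-irrefl (trans (cong (λ d → suc c + d) k≡) (m+[n∸m]≡n c≤C)) beyondC

  foldl-pakAdd-entry : ∀ {R C l r c} → LinearExtension R C l → Rect R C (r , c) →
                       foldl (pakAdd f) (λ _ → + 0) l (r , c) ≡ entry ((R ∸ r) ⊓ (C ∸ c)) r c
  foldl-pakAdd-entry {l = l} ext =
    complete⇒entry (growthInvariant-foldl ext l refl growthInvariant-[]) (LinearExtension.complete ext)

  foldl-pakAdd-independent : ∀ {R C l l′ x} → LinearExtension R C l → LinearExtension R C l′ → Rect R C x →
                             foldl (pakAdd f) (λ _ → + 0) l x ≡ foldl (pakAdd f) (λ _ → + 0) l′ x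
  foldl-pakAdd-independent ext ext′ x∈R = trans (foldl-pakAdd-entry ext x∈R) (sym (foldl-pakAdd-entry ext′ x∈R))

-- Row-major order

_<ₗₑₓ_ : Cell → Cell → Set
_<ₗₑₓ_ = ×-Lex _≡_ _<_ _<_

<ₗₑₓ-northWest⇒⊥ : ∀ {i j r c} → (i , j) <ₗₑₓ (r , c) → r ≤ i → c ≤ j → ⊥
<ₗₑₓ-northWest⇒⊥ (inj₁ i<r)         r≤i _   = <⇒≱ i<r r≤i
<ₗₑₓ-northWest⇒⊥ (inj₂ (refl , j<c)) _   c≤j = <⇒≱ j<c c≤j

cartesianProduct-sorted : ∀ {xs ys} → AllPairs _<_ xs → AllPairs _<_ ys → AllPairs _<ₗₑₓ_ (cartesianProduct xs ys)
cartesianProduct-sorted {[]}     _                 _        = []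
cartesianProduct-sorted {x ∷ xs} {ys} (x<xs ∷ xs↑) ys↑ =
  AllPairs.++⁺ (AllPairs.map⁺ (AllPairs.map (λ y<y′ → inj₂ (refl , y<y′)) ys↑))
               (cartesianProduct-sorted xs↑ ys↑)
               (All.tabulate λ x,y∈ → All.tabulate λ x′,y′∈ → rowBefore x,y∈ x′,y′∈)
  where
  rowBefore : ∀ {u v} → u ∈ map (x ,_) ys → v ∈ cartesianProduct xs ys → u <ₗₑₓ v
  rowBefore {v = v} u∈ v∈ with ∈-map⁻ (x ,_) u∈
  ... | _ , _ , refl = inj₁ (All.lookup x<xs (proj₁ (∈-cartesianProduct⁻ xs ys v∈)))

∈-range⁻ : ∀ {lo hi k} → k ∈ range lo hi → lo ≤ k × k ≤ hi
∈-range⁻ {lo} {hi} k∈ with ∈-filter⁻ (T? ∘ (lo ≤ᵇ_)) k∈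
... | k∈upTo , lo≤ᵇk = ≤ᵇ⇒≤ lo _ lo≤ᵇk , ≤-pred (∈-upTo⁻ k∈upTo)

∈-range⁺ : ∀ {lo hi k} → lo ≤ k → k ≤ hi → k ∈ range lo hi
∈-range⁺ {lo} lo≤k k≤hi = ∈-filter⁺ (T? ∘ (lo ≤ᵇ_)) (∈-upTo⁺ (s≤s k≤hi)) (≤⇒≤ᵇ lo≤k)

range-sorted : ∀ lo hi → AllPairs _<_ (range lo hi)
range-sorted lo hi = AllPairs.filter⁺ (T? ∘ (lo ≤ᵇ_)) (AllPairs.applyUpTo⁺₁ id (suc hi) (λ i<j _ → i<j))

rowMajor-linearExtension : ∀ R C → LinearExtension R C (cellsRowMajor R C)
rowMajor-linearExtension R C = record { inRect = inRect ; complete = complete ; addable = addable }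
  where
  inRect : ∀ {x} → x ∈ cellsRowMajor R C → Rect R C x
  inRect x∈ with ∈-cartesianProduct⁻ (range 1 R) (range 1 C) x∈
  ... | r∈ , c∈ = let 1≤r , r≤R = ∈-range⁻ r∈ ; 1≤c , c≤C = ∈-range⁻ c∈ in 1≤r , r≤R , 1≤c , c≤C
  complete : ∀ {x} → Rect R C x → x ∈ cellsRowMajor R C
  complete (1≤r , r≤R , 1≤c , c≤C) = ∈-cartesianProduct⁺ (∈-range⁺ 1≤r r≤R) (∈-range⁺ 1≤c c≤C)
  addable : ∀ {p i j q} → cellsRowMajor R C ≡ p ++ (i , j) ∷ q → Addable p i j
  addable {p} {i} {j} {q} eq = record
    { fresh      = λ e∈p → <ₗₑₓ-northWest⇒⊥ (All.lookup before e∈p) ≤-refl ≤-refl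
    ; aboveAdded = λ 1<i → earlier (∸-monoˡ-≤ 1 1<i , ≤-trans (m∸n≤m i 1) i≤R , 1≤j , j≤C)
                                   (m∸n≤m i 1) ≤-refl (λ x≡e → <-irrefl (cong proj₁ x≡e) (pred< 1<i))
    ; leftAdded  = λ 1<j → earlier (1≤i , i≤R , ∸-monoˡ-≤ 1 1<j , ≤-trans (m∸n≤m j 1) j≤C)
                                   ≤-refl (m∸n≤m j 1) (λ x≡e → <-irrefl (cong proj₂ x≡e) (pred< 1<j))
    }
    where
    sorted : All (_<ₗₑₓ (i , j)) p × All ((i , j) <ₗₑₓ_) q
    sorted = AllPairs-++-∷ p (subst (AllPairs _<ₗₑₓ_) eq
                                    (cartesianProduct-sorted (range-sorted 1 R) (range-sorted 1 C)))
    before = proj₁ sorted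
    after = proj₂ sorted
    e∈R : Rect R C (i , j)
    e∈R = inRect (subst ((i , j) ∈_) (sym eq) (∈-++⁺ʳ p (here refl)))
    1≤i = proj₁ e∈R
    i≤R = proj₁ (proj₂ e∈R)
    1≤j = proj₁ (proj₂ (proj₂ e∈R))
    j≤C = proj₂ (proj₂ (proj₂ e∈R))
    pred< : ∀ {n} → 1 < n → n ∸ 1 < n
    pred< (s≤s (s≤s _)) = ≤-refl
    earlier : ∀ {r c} → Rect R C (r , c) → r ≤ i → c ≤ j → (r , c) ≢ (i , j) → (r , c) ∈ p
    earlier x∈R r≤i c≤j x≢e with ∈-++⁻ p (subst (_ ∈_) eq (complete x∈R))
    ... | inj₁ x∈p = x∈p
    ... | inj₂ (here x≡e) = ⊥-elim (x≢e x≡e)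
    ... | inj₂ (there x∈q) = ⊥-elim (<ₗₑₓ-northWest⇒⊥ (All.lookup after x∈q) r≤i c≤j)

-- P_{Q,m} as the rectangle, and ρ_{Q,m} as Pak's algorithm

module Quiver (n m : ℕ) (1≤m : 1 ≤ m) (m≤n : m ≤ n) where

  InP : Ind → Set
  InP (a , b) = 1 ≤ a × a ≤ m × m ≤ b × b ≤ n

  inP? : ∀ x → Dec (InP x)
  inP? (a , b) = 1 ≤? a ×-dec a ≤? m ×-dec m ≤? b ×-dec b ≤? n

  OutsideP : Ind → Set
  OutsideP (a , b) = a ≡ 0 ⊎ m < a ⊎ b < m ⊎ n < b

  outside⇒∉P : ∀ {x} → OutsideP x → ¬ InP x
  outside⇒∉P (inj₁ refl)                (() , _)
  outside⇒∉P (inj₂ (inj₁ m<a))          (_ , a≤m , _)         = <⇒≱ m<a a≤m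
  outside⇒∉P (inj₂ (inj₂ (inj₁ b<m)))   (_ , _ , m≤b , _)     = <⇒≱ b<m m≤b
  outside⇒∉P (inj₂ (inj₂ (inj₂ n<b)))   (_ , _ , _ , b≤n)     = <⇒≱ n<b b≤n

  ∉P⇒outside : ∀ x → ¬ InP x → OutsideP x
  ∉P⇒outside (a , b) x∉P with 1 ≤? a | a ≤? m | m ≤? b | b ≤? n
  ... | no 1≰a | _       | _       | _       = inj₁ (n<1⇒n≡0 (≰⇒> 1≰a))
  ... | yes _  | no a≰m  | _       | _       = inj₂ (inj₁ (≰⇒> a≰m))
  ... | yes _  | yes _   | no m≰b  | _       = inj₂ (inj₂ (inj₁ (≰⇒> m≰b)))
  ... | yes _  | yes _   | yes _   | no b≰n  = inj₂ (inj₂ (inj₂ (≰⇒> b≰n)))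
  ... | yes p₁ | yes p₂  | yes p₃  | yes p₄  = ⊥-elim (x∉P (p₁ , p₂ , p₃ , p₄))

  inPᵇ-true : ∀ {x} → inPᵇ n m x ≡ true → InP x
  inPᵇ-true {x} eq = T-does⇒ (inP? x) (subst T (sym eq) tt)

  inPᵇ-false : ∀ {x} → inPᵇ n m x ≡ false → OutsideP x
  inPᵇ-false {x} eq = ∉P⇒outside x (λ x∈P → subst T eq (⇒T-does (inP? x) x∈P))

  cellOf-injective : ∀ {x y} → InP x → InP y → cellOf n x ≡ cellOf n y → x ≡ y
  cellOf-injective (_ , _ , _ , b≤n) (_ , _ , _ , b′≤n) eq =
    cong₂ _,_ (cong proj₂ eq) (∸-cancelˡ-≡ (m≤n⇒m≤1+n b≤n) (m≤n⇒m≤1+n b′≤n) (cong proj₁ eq))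

  cellOf-suc : ∀ {a b} → b ≤ n → cellOf n (suc a , b) ≡ (suc (n ∸ b) , suc a)
  cellOf-suc {a} b≤n = cong (_, suc a) (+-∸-assoc 1 b≤n)

  cellOf∈Rect : ∀ {x} → InP x → Rect (suc n ∸ m) m (cellOf n x)
  cellOf∈Rect (1≤a , a≤m , m≤b , b≤n) =
    subst (1 ≤_) (sym (+-∸-assoc 1 b≤n)) (s≤s z≤n) , ∸-monoʳ-≤ (suc n) m≤b , 1≤a , a≤m

  τ⁻¹-left : ℕ → ℕ
  τ⁻¹-left a = if a ≡ᵇ 1 then suc m else (if a ≤ᵇ m then a ∸ 1 else suc a)

  τ⁻¹-right : ℕ → ℕ
  τ⁻¹-right b = if b ≡ᵇ n then m ∸ 1 else (if m ≤ᵇ b then suc b else b ∸ 1)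

  tauInv-just : ∀ {a b Y} → tauInv n m (a , b) ≡ just Y → Y ≡ (τ⁻¹-left a , τ⁻¹-right b)
  tauInv-just {a} {b} eq with τ⁻¹-left a ≤ᵇ τ⁻¹-right b
  tauInv-just refl | true = refl
  tauInv-just ()   | false

  τ⁻¹-left-inner : ∀ {a} → 1 < a → a ≤ m → τ⁻¹-left a ≡ a ∸ 1
  τ⁻¹-left-inner {a} 1<a a≤m = trans (if-no (a ≟ 1) λ { refl → <-irrefl refl 1<a }) (if-yes (a ≤? m) a≤m)

  τ⁻¹-left-beyond : ∀ {a} → m < a → τ⁻¹-left a ≡ suc a
  τ⁻¹-left-beyond {a} m<a =
    trans (if-no (a ≟ 1) λ { refl → <⇒≱ m<a 1≤m }) (if-no (a ≤? m) (<⇒≱ m<a))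

  τ⁻¹-right-inner : ∀ {b} → m ≤ b → b < n → τ⁻¹-right b ≡ suc b
  τ⁻¹-right-inner {b} m≤b b<n = trans (if-no (b ≟ n) λ { refl → <-irrefl refl b<n }) (if-yes (m ≤? b) m≤b)

  τ⁻¹-right-below : ∀ {b} → b < m → τ⁻¹-right b ≡ b ∸ 1
  τ⁻¹-right-below {b} b<m =
    trans (if-no (b ≟ n) λ { refl → <⇒≱ b<m m≤n }) (if-no (m ≤? b) (<⇒≱ b<m))

  τ⁻¹-right-beyond : ∀ {b} → n < b → τ⁻¹-right b ≡ suc b
  τ⁻¹-right-beyond {b} n<b =
    trans (if-no (b ≟ n) λ { refl → <-irrefl refl n<b }) (if-yes (m ≤? b) (≤-trans m≤n (<⇒≤ n<b)))

  m∸1<m : m ∸ 1 < m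
  m∸1<m = ∸-monoʳ-< (s≤s z≤n) 1≤m

  τ⁻¹-outside : ∀ {X Y} → OutsideP X → tauInv n m X ≡ just Y → OutsideP Y
  τ⁻¹-outside {a , b} out eq rewrite tauInv-just {a} {b} eq with out
  ... | inj₁ refl                = inj₁ refl
  ... | inj₂ (inj₁ m<a)          = inj₂ (inj₁ (subst (m <_) (sym (τ⁻¹-left-beyond m<a)) (m<n⇒m<1+n m<a)))
  ... | inj₂ (inj₂ (inj₁ b<m))   = inj₂ (inj₂ (inj₁ (subst (_< m) (sym (τ⁻¹-right-below b<m))
                                                          (≤-<-trans (m∸n≤m b 1) b<m))))
  ... | inj₂ (inj₂ (inj₂ n<b))   = inj₂ (inj₂ (inj₂ (subst (n <_) (sym (τ⁻¹-right-beyond n<b)) (m<n⇒m<1+n n<b))))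

  τ⁻¹-boundary : ∀ {a b Y} → a ≡ 1 ⊎ b ≡ n → tauInv n m (a , b) ≡ just Y → OutsideP Y
  τ⁻¹-boundary {b = b} (inj₁ refl) eq rewrite tauInv-just {1} {b} eq = inj₂ (inj₁ ≤-refl)
  τ⁻¹-boundary {a} (inj₂ refl) eq rewrite tauInv-just {a} {n} eq =
    inj₂ (inj₂ (inj₁ (subst (_< m) (sym (if-yes (n ≟ n) refl)) m∸1<m)))

  τ⁻¹-inner : ∀ {a b} → 1 < a → a ≤ m → m ≤ b → b < n → tauInv n m (a , b) ≡ just (a ∸ 1 , suc b)
  τ⁻¹-inner {a} {b} 1<a a≤m m≤b b<n rewrite τ⁻¹-left-inner 1<a a≤m | τ⁻¹-right-inner m≤b b<n =
    if-yes (a ∸ 1 ≤? suc b) (≤-trans (m∸n≤m a 1) (≤-trans a≤m (m≤n⇒m≤1+n m≤b)))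

  τ⁻¹-inner∈P : ∀ {a b} → suc (suc a) ≤ m → m ≤ b → b < n → InP (suc a , suc b)
  τ⁻¹-inner∈P a≤m m≤b b<n = s≤s z≤n , ≤-trans (n≤1+n _) a≤m , m≤n⇒m≤1+n m≤b , b<n

  orbit-step : ∀ {F X Y x} → tauInv n m X ≡ just Y → x ∈ orbitFuel n m (suc F) X → x ≡ Y ⊎ x ∈ orbitFuel n m F Y
  orbit-step {X = X} eq x∈ with tauInv n m X | eq | x∈
  ... | just _ | refl | here x≡Y  = inj₁ x≡Y
  ... | just _ | refl | there x∈′ = inj₂ x∈′

  orbit-step⁺ : ∀ {F X Y x} → tauInv n m X ≡ just Y → x ≡ Y ⊎ x ∈ orbitFuel n m F Y → x ∈ orbitFuel n m (suc F) X
  orbit-step⁺ {X = X} eq x∈ with tauInv n m X | eq | x∈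
  ... | just _ | refl | inj₁ x≡Y  = here x≡Y
  ... | just _ | refl | inj₂ x∈′ = there x∈′

  orbit-outside : ∀ F {X x} → OutsideP X → x ∈ orbitFuel n m F X → OutsideP x
  orbit-outside (suc F) {X} out x∈ with tauInv n m X in eq | x∈
  ... | just _ | here refl  = τ⁻¹-outside out eq
  ... | just _ | there x∈′ = orbit-outside F (τ⁻¹-outside out eq) x∈′

  orbit-from-boundary : ∀ F {a b x} → a ≡ 1 ⊎ b ≡ n → x ∈ orbitFuel n m F (a , b) → OutsideP x
  orbit-from-boundary (suc F) {a} {b} boundary x∈ with tauInv n m (a , b) in eq | x∈
  ... | just _ | here refl  = τ⁻¹-boundary boundary eq
  ... | just _ | there x∈′ = orbit-outside F (τ⁻¹-boundary boundary eq) x∈′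

  orbit⇒⋱ : ∀ F {X x} → InP X → InP x → x ∈ orbitFuel n m F X → cellOf n x ⋱ cellOf n X
  orbit⇒⋱ F {suc zero , b} _ x∈P x∈ = ⊥-elim (outside⇒∉P (orbit-from-boundary F (inj₁ refl) x∈) x∈P)
  orbit⇒⋱ (suc F) {suc (suc a) , b} {x} (_ , a≤m , m≤b , b≤n) x∈P x∈ with b ≟ n
  ... | yes b≡n = ⊥-elim (outside⇒∉P (orbit-from-boundary (suc F) {suc (suc a)} (inj₂ b≡n) x∈) x∈P)
  ... | no b≢n =
    subst (cellOf n x ⋱_) (sym (cellOf-suc b≤n))
      (⋱-suc⁺ (Sum.map (cong (cellOf n)) (orbit⇒⋱ F (τ⁻¹-inner∈P a≤m m≤b b<n) x∈P)
                 (orbit-step {X = suc (suc a) , b} (τ⁻¹-inner (s≤s (s≤s z≤n)) a≤m m≤b b<n) x∈)))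
    where
    b<n = ≤∧≢⇒< b≤n b≢n

  ⋱⇒orbit : ∀ F {X x} → proj₁ X ≤ F → InP X → InP x → cellOf n x ⋱ cellOf n X → x ∈ orbitFuel n m F X
  ⋱⇒orbit F {suc zero , b} _ _ x∈P x⋱X = ⊥-elim (<⇒≱ (proj₁ (proj₂ (⋱⇒diff x⋱X))) (proj₁ x∈P))
  ⋱⇒orbit (suc F) {suc (suc a) , b} {x} (s≤s a<F) (_ , a≤m , m≤b , b≤n) x∈P x⋱X with b ≟ n
  ... | yes b≡n =
    ⊥-elim (<⇒≱ (subst (proj₁ (cellOf n x) <_) firstRow (proj₁ (⋱⇒diff x⋱X))) (proj₁ (cellOf∈Rect x∈P)))
    where
    firstRow : suc n ∸ b ≡ 1
    firstRow = trans (cong (suc n ∸_) b≡n) (m+n∸n≡m 1 n)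
  ... | no b≢n =
    orbit-step⁺ {X = suc (suc a) , b} (τ⁻¹-inner (s≤s (s≤s z≤n)) a≤m m≤b b<n)
      (Sum.map (cellOf-injective x∈P Y∈P) (⋱⇒orbit F a<F Y∈P x∈P)
               (⋱-suc⁻ (subst (cellOf n x ⋱_) (cellOf-suc b≤n) x⋱X)))
    where
    b<n = ≤∧≢⇒< b≤n b≢n
    Y∈P = τ⁻¹-inner∈P a≤m m≤b b<n

  ≤orbitFuel : ∀ {a} → a ≤ m → a ≤ n * n
  ≤orbitFuel a≤m = ≤-trans a≤m (≤-trans m≤n (m≤m*n n n {{>-nonZero (≤-trans 1≤m m≤n)}}))

  Matches : (Ind → ℤ) → (Cell → ℤ) → Set
  Matches ρ π = ∀ {x} → InP x → ρ x ≡ π (cellOf n x)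

  keepInside : ∀ {x} → InP x → filterᵇ (inPᵇ n m) (x ∷ []) ≡ x ∷ []
  keepInside {x} x∈P = filter-accept (T? ∘ inPᵇ n m) (⇒T-does (inP? x) x∈P)

  dropOutside : ∀ c {y} → OutsideP y → filterᵇ (inPᵇ n m) (if c then y ∷ [] else []) ≡ []
  dropOutside true  {y} out = filter-reject (T? ∘ inPᵇ n m) {y} {[]} (outside⇒∉P out ∘ T-does⇒ (inP? y))
  dropOutside false _       = refl

  ∈allIntervals : ∀ {x} → InP x → x ∈ allIntervals n
  ∈allIntervals {a , b} (1≤a , a≤m , m≤b , b≤n) =
    ∈-filter⁺ (T? ∘ λ x → (1 ≤ᵇ proj₁ x) ∧ (proj₁ x ≤ᵇ proj₂ x))
              (∈-cartesianProduct⁺ (∈-upTo⁺ (s≤s (≤-trans a≤b b≤n))) (∈-upTo⁺ (s≤s b≤n)))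
              (⇒T-does (1 ≤? a ×-dec a ≤? b) (1≤a , a≤b))
    where
    a≤b = ≤-trans a≤m m≤b

  ∈Pelems : ∀ {x} → InP x → x ∈ Pelems n m
  ∈Pelems {x} x∈P = ∈-filter⁺ (T? ∘ inPᵇ n m) (∈allIntervals x∈P) (⇒T-does (inP? x) x∈P)

  ∈lowerCovers⁺ : ∀ {x z} → InP z → x ∈ arrowsOut n m z → z ∈ lowerCovers n m x
  ∈lowerCovers⁺ {x} {z} z∈P z→x =
    ∈-filter⁺ (T? ∘ λ z → any (_== x) (arrowsOut n m z)) (∈Pelems z∈P) (⇒T-does (x ∈ᵢ? arrowsOut n m z) z→x)

  ∈lowerCovers⁻ : ∀ {x z} → z ∈ lowerCovers n m x → x ∈ arrowsOut n m z
  ∈lowerCovers⁻ {x} {z} z∈ =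
    T-does⇒ (x ∈ᵢ? arrowsOut n m z)
            (proj₂ (∈-filter⁻ (T? ∘ λ z → any (_== x) (arrowsOut n m z)) {xs = Pelems n m} z∈))

  leftArrows : ℕ → ℕ → List Ind
  leftArrows a b = if (1 <ᵇ a) ∧ (a ≤ᵇ m) then (a ∸ 1 , b) ∷ []
                   else (if (suc a ⊔ suc m) ≤ᵇ b then (suc a ⊔ suc m , b) ∷ [] else [])

  rightArrows : ℕ → ℕ → List Ind
  rightArrows a b = if (m ≤ᵇ b) ∧ (b <ᵇ n) then (a , suc b) ∷ []
                    else (if a ≤ᵇ ((b ∸ 1) ⊓ (m ∸ 1)) then (a , (b ∸ 1) ⊓ (m ∸ 1)) ∷ [] else [])

  arrowsOut-halves : ∀ a b → arrowsOut n m (a , b) ≡ leftArrows a b ++ rightArrows a b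
  arrowsOut-halves a b = refl

  arrow-above : ∀ {a b} → m ≤ b → b < n → (a , suc b) ∈ arrowsOut n m (a , b)
  arrow-above {a} {b} m≤b b<n =
    ∈-++⁺ʳ (leftArrows a b) (subst ((a , suc b) ∈_) (sym (if-yes (m ≤? b ×-dec b <? n) (m≤b , b<n))) (here refl))

  arrow-left : ∀ {a b} → 1 < a → a ≤ m → (a ∸ 1 , b) ∈ arrowsOut n m (a , b)
  arrow-left {a} {b} 1<a a≤m =
    ∈-++⁺ˡ (subst ((a ∸ 1 , b) ∈_) (sym (if-yes (1 <? a ×-dec a ≤? m) (1<a , a≤m))) (here refl))

  leftArrows-value : ∀ {ρ π a b} → Matches ρ π → InP (a , b) →
              map ρ (filterᵇ (inPᵇ n m) (leftArrows a b)) ≡ (if 1 <ᵇ a then π (suc n ∸ b , a ∸ 1) ∷ [] else [])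
  leftArrows-value {ρ} {a = suc zero} {b} _ _ =
    cong (map ρ) (dropOutside ((2 ⊔ suc m) ≤ᵇ b) (inj₂ (inj₁ (s≤s (m≤n⊔m 1 m)))))
  leftArrows-value {ρ} {π} {suc (suc a)} {b} match (_ , a≤m , m≤b , b≤n) = begin
    map ρ (filterᵇ (inPᵇ n m) (leftArrows (suc (suc a)) b))
      ≡⟨ cong (map ρ ∘ filterᵇ (inPᵇ n m))
              (if-yes (1 <? suc (suc a) ×-dec suc (suc a) ≤? m) (s≤s (s≤s z≤n) , a≤m)) ⟩
    map ρ (filterᵇ (inPᵇ n m) ((suc a , b) ∷ []))  ≡⟨ cong (map ρ) (keepInside left∈P) ⟩
    ρ (suc a , b) ∷ []                            ≡⟨ cong (_∷ []) (match left∈P) ⟩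
    π (suc n ∸ b , suc a) ∷ []                    ∎
    where
    left∈P : InP (suc a , b)
    left∈P = s≤s z≤n , ≤-trans (n≤1+n _) a≤m , m≤b , b≤n

  rightArrows-value : ∀ {ρ π a b} → Matches ρ π → InP (a , b) →
               map ρ (filterᵇ (inPᵇ n m) (rightArrows a b)) ≡
               (if 1 <ᵇ (suc n ∸ b) then π (suc n ∸ b ∸ 1 , a) ∷ [] else [])
  rightArrows-value {ρ} {π} {a} {b} match (1≤a , a≤m , m≤b , b≤n) with b <? n
  ... | yes b<n = begin
    map ρ (filterᵇ (inPᵇ n m) (rightArrows a b))
      ≡⟨ cong (map ρ ∘ filterᵇ (inPᵇ n m)) (if-yes (m ≤? b ×-dec b <? n) (m≤b , b<n)) ⟩
    map ρ (filterᵇ (inPᵇ n m) ((a , suc b) ∷ [])) ≡⟨ cong (map ρ) (keepInside above∈P) ⟩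
    ρ (a , suc b) ∷ []                           ≡⟨ cong (_∷ []) (match above∈P) ⟩
    π (n ∸ b , a) ∷ []                           ≡⟨ cong (λ r → π (r ∸ 1 , a) ∷ []) (+-∸-assoc 1 b≤n) ⟨
    π (suc n ∸ b ∸ 1 , a) ∷ []                   ≡⟨ if-yes (1 <? suc n ∸ b) notFirstRow ⟨
    (if 1 <ᵇ (suc n ∸ b) then π (suc n ∸ b ∸ 1 , a) ∷ [] else []) ∎
    where
    above∈P : InP (a , suc b)
    above∈P = 1≤a , a≤m , m≤n⇒m≤1+n m≤b , b<n
    notFirstRow : 1 < suc n ∸ b
    notFirstRow = subst (1 <_) (sym (+-∸-assoc 1 b≤n)) (s≤s (m<n⇒0<n∸m b<n))
  ... | no b≮n = begin
    map ρ (filterᵇ (inPᵇ n m) (rightArrows a b))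
      ≡⟨ cong (map ρ ∘ filterᵇ (inPᵇ n m)) (if-no (m ≤? b ×-dec b <? n) (b≮n ∘ proj₂)) ⟩
    map ρ (filterᵇ (inPᵇ n m) (if a ≤ᵇ ((b ∸ 1) ⊓ (m ∸ 1)) then (a , (b ∸ 1) ⊓ (m ∸ 1)) ∷ [] else []))
      ≡⟨ cong (map ρ) (dropOutside (a ≤ᵇ ((b ∸ 1) ⊓ (m ∸ 1)))
                                   (inj₂ (inj₂ (inj₁ (≤-<-trans (m⊓n≤n _ _) m∸1<m))))) ⟩
    []
      ≡⟨ if-no (1 <? suc n ∸ b) firstRow ⟨
    (if 1 <ᵇ (suc n ∸ b) then π (suc n ∸ b ∸ 1 , a) ∷ [] else []) ∎
    where
    firstRow : ¬ 1 < suc n ∸ b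
    firstRow 1<r = <⇒≱ 1<r (≤-trans (∸-monoʳ-≤ (suc n) (≮⇒≥ b≮n)) (≤-reflexive (m+n∸n≡m 1 n)))

  upperCovers-value : ∀ {ρ π x} → Matches ρ π → InP x → maxL (map ρ (upperCovers n m x)) ≡ nwMax π (cellOf n x)
  upperCovers-value {ρ} {π} {a , b} match x∈P = begin
    maxL (map ρ (upperCovers n m (a , b)))
      ≡⟨ cong (maxL ∘ map ρ ∘ filterᵇ (inPᵇ n m)) (arrowsOut-halves a b) ⟩
    maxL (map ρ (filterᵇ (inPᵇ n m) (leftArrows a b ++ rightArrows a b)))
      ≡⟨ cong (maxL ∘ map ρ) (filter-++ (T? ∘ inPᵇ n m) (leftArrows a b) (rightArrows a b)) ⟩
    maxL (map ρ (filterᵇ (inPᵇ n m) (leftArrows a b) ++ filterᵇ (inPᵇ n m) (rightArrows a b)))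
      ≡⟨ cong maxL (map-++ ρ (filterᵇ (inPᵇ n m) (leftArrows a b)) _) ⟩
    maxL (map ρ (filterᵇ (inPᵇ n m) (leftArrows a b)) ++ map ρ (filterᵇ (inPᵇ n m) (rightArrows a b)))
      ≡⟨ cong maxL (cong₂ _++_ (leftArrows-value {π = π} match x∈P) (rightArrows-value {π = π} match x∈P)) ⟩
    maxL ((if 1 <ᵇ a then π (suc n ∸ b , a ∸ 1) ∷ [] else []) ++
          (if 1 <ᵇ (suc n ∸ b) then π (suc n ∸ b ∸ 1 , a) ∷ [] else []))
      ≡⟨ maxL-swap (1 <ᵇ a) (1 <ᵇ (suc n ∸ b)) _ _ ⟩
    nwMax π (suc n ∸ b , a) ∎

  leftArrows-into : ∀ {a b a₂ b₂} → a ≤ m → (a , b) ∈ leftArrows a₂ b₂ → (a₂ , b₂) ≡ (suc a , b)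
  leftArrows-into {a₂ = a₂} {b₂} a≤m y∈ with (1 <ᵇ a₂) ∧ (a₂ ≤ᵇ m) in guard | y∈
  ... | true  | here refl = cong (_, b₂) (+-∸-assoc 1 (<⇒≤ 1<a₂))
    where
    1<a₂ : 1 < a₂
    1<a₂ = proj₁ (T-does⇒ (1 <? a₂ ×-dec a₂ ≤? m) (subst T (sym guard) tt))
  ... | false | y∈′ with (suc a₂ ⊔ suc m) ≤ᵇ b₂ | y∈′
  ...   | true | here refl = ⊥-elim (<⇒≱ (s≤s (m≤n⊔m a₂ m)) a≤m)

  rightArrows-into : ∀ {a b a₂ b₂} → m ≤ b → (a , b) ∈ rightArrows a₂ b₂ → (a₂ , b₂) ≡ (a , b ∸ 1)
  rightArrows-into {a₂ = a₂} {b₂} m≤b y∈ with (m ≤ᵇ b₂) ∧ (b₂ <ᵇ n) | y∈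
  ... | true  | here refl = refl
  ... | false | y∈′ with a₂ ≤ᵇ ((b₂ ∸ 1) ⊓ (m ∸ 1)) | y∈′
  ...   | true | here refl = ⊥-elim (<⇒≱ (≤-<-trans (m⊓n≤n _ _) m∸1<m) m≤b)

  arrowsOut-into : ∀ {a b z} → InP (a , b) → (a , b) ∈ arrowsOut n m z → z ≡ (suc a , b) ⊎ z ≡ (a , b ∸ 1)
  arrowsOut-into {z = a₂ , b₂} (_ , a≤m , m≤b , _) y∈ with ∈-++⁻ (leftArrows a₂ b₂) y∈
  ... | inj₁ y∈left  = inj₁ (leftArrows-into a≤m y∈left)
  ... | inj₂ y∈right = inj₂ (rightArrows-into m≤b y∈right)

  lowerCovers-value : ∀ N {ρ π a b} → Matches ρ π → InP (a , b) → a < m → m < b →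
                      minL (+ N) (map ρ (lowerCovers n m (a , b))) ≡
                      π (suc (suc n ∸ b) , a) ℤ.⊓ π (suc n ∸ b , suc a)
  lowerCovers-value N {ρ} {π} {a} {suc b} match x∈P@(1≤a , a≤m , _ , b<n) a<m (s≤s m≤b) = begin
    minL (+ N) (map ρ (lowerCovers n m (a , suc b)))
      ≡⟨ minL-pair (+ N) _ (∈-map⁺ ρ (∈lowerCovers⁺ below∈P fromBelow))
                           (∈-map⁺ ρ (∈lowerCovers⁺ right∈P fromRight)) onlyBelowOrRight ⟩
    ρ (a , b) ℤ.⊓ ρ (suc a , suc b)
      ≡⟨ cong₂ ℤ._⊓_ (match below∈P) (match right∈P) ⟩
    π (suc n ∸ b , a) ℤ.⊓ π (n ∸ b , suc a)
      ≡⟨ cong (λ r → π (r , a) ℤ.⊓ π (n ∸ b , suc a)) (+-∸-assoc 1 b≤n) ⟩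
    π (suc (n ∸ b) , a) ℤ.⊓ π (n ∸ b , suc a) ∎
    where
    b≤n = <⇒≤ b<n
    below∈P : InP (a , b)
    below∈P = 1≤a , a≤m , m≤b , b≤n
    right∈P : InP (suc a , suc b)
    right∈P = s≤s z≤n , a<m , m≤n⇒m≤1+n m≤b , b<n
    fromBelow : (a , suc b) ∈ arrowsOut n m (a , b)
    fromBelow = arrow-above m≤b b<n
    fromRight : (a , suc b) ∈ arrowsOut n m (suc a , suc b)
    fromRight = arrow-left (s≤s 1≤a) a<m
    onlyBelowOrRight : ∀ {v} → v ∈ map ρ (lowerCovers n m (a , suc b)) → v ≡ ρ (a , b) ⊎ v ≡ ρ (suc a , suc b)
    onlyBelowOrRight v∈ with ∈-map⁻ ρ v∈
    ... | z , z∈ , refl with arrowsOut-into x∈P (∈lowerCovers⁻ z∈)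
    ...   | inj₁ refl = inj₂ refl
    ...   | inj₂ refl = inj₁ refl

  hookWeights-cellOf : ∀ M {x} → InP x → hookWeights n M (cellOf n x) ≡ M x
  hookWeights-cellOf M {a , b} (_ , _ , _ , b≤n) = cong (λ b′ → M (a , b′)) (m∸[m∸n]≡n (m≤n⇒m≤1+n b≤n))

  rhoStep-new : ∀ {N M ρ x} → InP x → rhoStep n m N M ρ x x ≡ maxL (map ρ (upperCovers n m x)) ℤ.+ + M x
  rhoStep-new {x = x} x∈P = trans (if-yes (inP? x) x∈P) (if-yes (x ≟² x) refl)

  rhoStep-toggle : ∀ {N M ρ X x} → InP x → x ≢ X → x ∈ negTauOrbit n m X →
                   rhoStep n m N M ρ X x ≡ toggleAt n m N ρ x
  rhoStep-toggle {X = X} {x} x∈P x≢X x∈orbit =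
    trans (if-yes (inP? x) x∈P) (trans (if-no (x ≟² X) x≢X) (if-yes (x ∈ᵢ? negTauOrbit n m X) x∈orbit))

  rhoStep-keep : ∀ {N M ρ X x} → InP x → x ≢ X → x ∉ negTauOrbit n m X → rhoStep n m N M ρ X x ≡ ρ x
  rhoStep-keep {X = X} {x} x∈P x≢X x∉orbit =
    trans (if-yes (inP? x) x∈P) (trans (if-no (x ≟² X) x≢X) (if-no (x ∈ᵢ? negTauOrbit n m X) x∉orbit))

  rhoStep-outside : ∀ {N M ρ π X} → OutsideP X → Matches ρ π → Matches (rhoStep n m N M ρ X) π
  rhoStep-outside {N} {M} out match x∈P =
    trans (rhoStep-keep {N} {M} x∈P (λ { refl → outside⇒∉P out x∈P })
                                    (λ x∈ → outside⇒∉P (orbit-outside (n * n) out x∈) x∈P))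
          (match x∈P)

  rhoStep-inside : ∀ {N M ρ π X} → InP X → Matches ρ π →
                   Matches (rhoStep n m N M ρ X) (pakAdd (hookWeights n M) π (cellOf n X))
  rhoStep-inside {N} {M} {ρ} {π} {X} X∈P match {x} x∈P with x ≟² X
  ... | yes refl = begin
    rhoStep n m N M ρ x x
      ≡⟨ rhoStep-new {N} {M} x∈P ⟩
    maxL (map ρ (upperCovers n m x)) ℤ.+ + M x
      ≡⟨ cong₂ ℤ._+_ (upperCovers-value {π = π} match x∈P) (cong +_ (sym (hookWeights-cellOf M x∈P))) ⟩
    nwMax π (cellOf n x) ℤ.+ + hookWeights n M (cellOf n x)
      ≡⟨ pakAdd-new (hookWeights n M) π (cellOf n x) ⟨
    pakAdd (hookWeights n M) π (cellOf n x) (cellOf n x) ∎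
  ... | no x≢X with cellOf n x ⋱? cellOf n X
  ...   | yes x⋱X = begin
    rhoStep n m N M ρ X x
      ≡⟨ rhoStep-toggle {N} {M} x∈P x≢X x∈orbit ⟩
    toggleAt n m N ρ x
      ≡⟨ cong₂ ℤ._-_ (cong₂ ℤ._+_ (upperCovers-value {π = π} match x∈P)
                                  (lowerCovers-value N {π = π} match x∈P a<m m<b))
                     (match x∈P) ⟩
    toggle π (cellOf n x)
      ≡⟨ pakAdd-toggled (hookWeights n M) π x⋱X ⟨
    pakAdd (hookWeights n M) π (cellOf n X) (cellOf n x) ∎
    where
    x∈orbit : x ∈ negTauOrbit n m X
    x∈orbit = ⋱⇒orbit (n * n) (≤orbitFuel (proj₁ (proj₂ X∈P))) X∈P x∈P x⋱X
    a<m : proj₁ x < m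
    a<m = <-≤-trans (proj₁ (proj₂ (⋱⇒diff x⋱X))) (proj₁ (proj₂ X∈P))
    m<b : m < proj₂ x
    m<b = ≤-<-trans (proj₁ (proj₂ (proj₂ X∈P))) (∸-cancelʳ-< (proj₁ (⋱⇒diff x⋱X)))
  ...   | no ¬x⋱X = begin
    rhoStep n m N M ρ X x
      ≡⟨ rhoStep-keep {N} {M} x∈P x≢X (¬x⋱X ∘ orbit⇒⋱ (n * n) X∈P x∈P) ⟩
    ρ x
      ≡⟨ match x∈P ⟩
    π (cellOf n x)
      ≡⟨ pakAdd-untouched (hookWeights n M) π (x≢X ∘ cellOf-injective x∈P X∈P) ¬x⋱X ⟨
    pakAdd (hookWeights n M) π (cellOf n X) (cellOf n x) ∎

  cellsOf : List Ind → List Cell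
  cellsOf L = map (cellOf n) (filterᵇ (inPᵇ n m) L)

  foldl-rhoStep-matches : ∀ {N M} L {ρ π} → Matches ρ π →
                          Matches (foldl (rhoStep n m N M) ρ L) (foldl (pakAdd (hookWeights n M)) π (cellsOf L))
  foldl-rhoStep-matches              []      match = match
  foldl-rhoStep-matches {N} {M} (X ∷ L) {ρ} {π} match with inPᵇ n m X in X∈?
  ... | true  = foldl-rhoStep-matches L (rhoStep-inside {N} {M} {ρ} {π} (inPᵇ-true X∈?) match)
  ... | false = foldl-rhoStep-matches L (rhoStep-outside {N} {M} {ρ} {π} (inPᵇ-false X∈?) match)

  cell∈cellsOf : ∀ {xs x} → x ∈ xs → InP x → cellOf n x ∈ cellsOf xs
  cell∈cellsOf {x = x} x∈ x∈P = ∈-map⁺ (cellOf n) (∈-filter⁺ (T? ∘ inPᵇ n m) x∈ (⇒T-does (inP? x) x∈P))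

  cellsOf⁻ : ∀ {xs y} → y ∈ cellsOf xs → ∃[ x ] x ∈ xs × InP x × y ≡ cellOf n x
  cellsOf⁻ {xs} y∈ with ∈-map⁻ (cellOf n) y∈
  ... | x , x∈ , refl with ∈-filter⁻ (T? ∘ inPᵇ n m) {xs = xs} x∈
  ...   | x∈xs , T-x∈P = x , x∈xs , T-does⇒ (inP? x) T-x∈P , refl

  allIntervals-unique : Unique (allIntervals n)
  allIntervals-unique = Unique.filter⁺ (T? ∘ λ x → (1 ≤ᵇ proj₁ x) ∧ (proj₁ x ≤ᵇ proj₂ x))
                                       (Unique.cartesianProduct⁺ (Unique.upTo⁺ (suc n)) (Unique.upTo⁺ (suc n)))

  listing-unique : ∀ {L} → ValidListing n m L → Unique L
  listing-unique (L↭ , _) = Permutationₛ.Unique-resp-↭ (setoid Ind) (↭⇒↭ₛ (↭-sym L↭)) allIntervals-unique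

  listing-complete : ∀ {L x} → ValidListing n m L → InP x → x ∈ L
  listing-complete (L↭ , _) x∈P = ∈-resp-↭ (↭-sym L↭) (∈allIntervals x∈P)

  successor-earlier : ∀ {p e q y} → ValidListing n m (p ++ e ∷ q) → ARArrow n m e y → y ∈ p ++ e ∷ q → y ∈ p
  successor-earlier {p} (_ , ordered) e→y y∈L with ∈-++⁻ p y∈L
  ... | inj₁ y∈p   = y∈p
  ... | inj₂ y∈e∷q = ⊥-elim (<⇒≱ (ordered (Any.index e∈) (Any.index y∈) e→y′) e≤y)
    where
    e∈ = ∈-++⁺ʳ p (here refl)
    y∈ = ∈-++⁺ʳ p y∈e∷q
    e→y′ = subst₂ (ARArrow n m) (lookup-index e∈) (lookup-index y∈) e→y
    e≤y : toℕ (Any.index e∈) ≤ toℕ (Any.index y∈)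
    e≤y = subst₂ _≤_ (sym (index-++⁺ʳ p (here refl))) (sym (index-++⁺ʳ p y∈e∷q))
                 (+-monoʳ-≤ (length p) z≤n)

  listing-addable : ∀ {L p i j q} → ValidListing n m L → cellsOf L ≡ p ++ (i , j) ∷ q → Addable p i j
  listing-addable {L} valid eq with map-filterᵇ-split (cellOf n) (inPᵇ n m) L eq
  ... | ps , (a , b) , qs , refl , refl , refl , T-X∈P =
    record { fresh = fresh ; aboveAdded = aboveAdded ; leftAdded = leftAdded }
    where
    X∈P : InP (a , b)
    X∈P = T-does⇒ (inP? (a , b)) T-X∈P
    1≤a = proj₁ X∈P
    a≤m = proj₁ (proj₂ X∈P)
    m≤b = proj₁ (proj₂ (proj₂ X∈P))
    b≤n = proj₂ (proj₂ (proj₂ X∈P))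
    earlier : ∀ {y} → InP y → ARArrow n m (a , b) y → cellOf n y ∈ cellsOf ps
    earlier y∈P X→y = cell∈cellsOf (successor-earlier valid X→y (listing-complete valid y∈P)) y∈P
    fresh : cellOf n (a , b) ∉ cellsOf ps
    fresh X∈ with cellsOf⁻ X∈
    ... | x , x∈ps , x∈P , X↦x = All.lookup (proj₁ (AllPairs-++-∷ ps (listing-unique valid))) x∈ps
                                   (sym (cellOf-injective X∈P x∈P X↦x))
    aboveAdded : 1 < suc n ∸ b → (suc n ∸ b ∸ 1 , a) ∈ cellsOf ps
    aboveAdded 1<r = subst (λ r → (r ∸ 1 , a) ∈ cellsOf ps) (sym (+-∸-assoc 1 b≤n))
                           (earlier above∈P (arrow-above m≤b b<n))
      where
      b<n : b < n
      b<n = ≤∧≢⇒< b≤n λ { refl → <-irrefl (sym (m+n∸n≡m 1 b)) 1<r }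
      above∈P : InP (a , suc b)
      above∈P = 1≤a , a≤m , m≤n⇒m≤1+n m≤b , b<n
    leftAdded : 1 < a → (suc n ∸ b , a ∸ 1) ∈ cellsOf ps
    leftAdded 1<a = earlier (∸-monoˡ-≤ 1 1<a , ≤-trans (m∸n≤m a 1) a≤m , m≤b , b≤n)
                            (arrow-left 1<a a≤m)

  listing-linearExtension : ∀ {L} → ValidListing n m L → LinearExtension (suc n ∸ m) m (cellsOf L)
  listing-linearExtension {L} valid = record
    { inRect   = inRect
    ; complete = complete
    ; addable  = listing-addable valid
    }
    where
    inRect : ∀ {y} → y ∈ cellsOf L → Rect (suc n ∸ m) m y
    inRect y∈ with cellsOf⁻ {L} y∈
    ... | _ , _ , x∈P , refl = cellOf∈Rect x∈P
    complete : ∀ {y} → Rect (suc n ∸ m) m y → y ∈ cellsOf L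
    complete {r , c} (1≤r , r≤R , 1≤c , c≤m) =
      subst (λ r′ → (r′ , c) ∈ cellsOf L) (m∸[m∸n]≡n r≤1+n) (cell∈cellsOf (listing-complete valid x∈P) x∈P)
      where
      r≤1+n : r ≤ suc n
      r≤1+n = ≤-trans r≤R (m∸n≤m (suc n) m)
      x∈P : InP (c , suc n ∸ r)
      x∈P = 1≤c , c≤m
          , ≤-trans (≤-reflexive (sym (m∸[m∸n]≡n (m≤n⇒m≤1+n m≤n)))) (∸-monoʳ-≤ (suc n) r≤R)
          , ∸-monoʳ-≤ (suc n) 1≤r

theorem11 : (n m : ℕ) → 1 ≤ m → m ≤ n →
            (L : List Ind) → ValidListing n m L →
            (N : ℕ) → (M : Ind → ℕ) →
            (a b : ℕ) → 1 ≤ a → a ≤ m → m ≤ b → b ≤ n →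
            rhoQm n m N L M (a , b) ≡ Pak n m M (cellOf n (a , b))
theorem11 n m 1≤m m≤n L valid N M a b 1≤a a≤m m≤b b≤n = begin
  rhoQm n m N L M (a , b)
    ≡⟨ foldl-rhoStep-matches L (λ _ → refl) x∈P ⟩
  foldl (pakAdd (hookWeights n M)) (λ _ → + 0) (cellsOf L) (cellOf n (a , b))
    ≡⟨ PakGrowth.foldl-pakAdd-independent (hookWeights n M) (listing-linearExtension valid)
         (rowMajor-linearExtension (suc n ∸ m) m) (cellOf∈Rect x∈P) ⟩
  Pak n m M (cellOf n (a , b)) ∎
  where
  open Quiver n m 1≤m m≤n
  x∈P : InP (a , b)
  x∈P = 1≤a , a≤m , m≤b , b≤n
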